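{- If $\Gamma$ is a finite set of formulas and $\psi$ a formula, then $\Gamma\models_{\sf LFI1}\psi$ if and only if $\Gamma,\text{☆}p_1,\dots,\text{☆}p_k\models_{\sf BD2}\psi$, where $p_1,\dots,p_k$ are the propositional variables occurring in $\Gamma\cup\{\psi\}$ and $\text{☆}\alpha:=\copyright\copyright\alpha$.
   Context: Let $\mathbf 4=\{1,\mathbf b,\mathbf n,0\}$ be the lattice with $0<\mathbf b<1$, $0<\mathbf n<1$, $\mathbf b,\mathbf n$ incomparable; $\wedge,\vee$ meet and join. The algebra ${\bf A}_{\sf BD2}$ on $\mathbf 4$ over $\{\wedge,\vee,\to,\neg,\copyright\}$ has: $\neg 1=0$, $\neg\mathbf b=\mathbf b$, $\neg\mathbf n=\mathbf n$, $\neg 0=1$; $\copyright 1=1$, $\copyright\mathbf b=0$, $\copyright\mathbf n=\mathbf b$, $\copyright 0=1$; $x\to y=y$ if $x\in\{1,\mathbf b\}$; $0\to y=1$; $\mathbf n\to 1=\mathbf n\to\mathbf n=1$, $\mathbf n\to\mathbf b=\mathbf n\to 0=\mathbf b$. ${\sf BD2}$ is the logic of the matrix $\langle{\bf A}_{\sf BD2},\{1,\mathbf b\}\rangle$ ($\Gamma\models\psi$ iff every valuation designating all of $\Gamma$ designates $\psi$). ${\sf LFI1}$ is the logic of the submatrix with domain $\{1,\mathbf b,0\}$ and designated set $\{1,\mathbf b\}$. -}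

module Defs where

open import Data.Nat using (ℕ)
open import Data.List using (List; []; _∷_; _++_; map; concatMap)
open import Data.List.Membership.Propositional using (_∈_)
open import Relation.Binary.PropositionalEquality using (_≡_; _≢_)

data V4 : Set where
  one b n zero : V4

_∧₄_ : V4 → V4 → V4
one ∧₄ y = y
zero ∧₄ y = zero
b ∧₄ one = b
b ∧₄ b = b
b ∧₄ n = zero
b ∧₄ zero = zero
n ∧₄ one = n
n ∧₄ b = zero
n ∧₄ n = n
n ∧₄ zero = zero

_∨₄_ : V4 → V4 → V4
one ∨₄ y = one
zero ∨₄ y = y
b ∨₄ one = one
b ∨₄ b = b
b ∨₄ n = one
b ∨₄ zero = b
n ∨₄ one = one
n ∨₄ b = one
n ∨₄ n = n
n ∨₄ zero = n

¬₄ : V4 → V4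
¬₄ one = zero
¬₄ b = b
¬₄ n = n
¬₄ zero = one

©₄ : V4 → V4
©₄ one = one
©₄ b = zero
©₄ n = b
©₄ zero = one

_⇒₄_ : V4 → V4 → V4
one ⇒₄ y = y
b ⇒₄ y = y
zero ⇒₄ y = one
n ⇒₄ one = one
n ⇒₄ n = one
n ⇒₄ b = b
n ⇒₄ zero = b

data Designated : V4 → Set where
  des-one : Designated one
  des-b   : Designated b

data Form : Set where
  var  : ℕ → Form
  _∧'_ : Form → Form → Form
  _∨'_ : Form → Form → Form
  _⇒'_ : Form → Form → Form
  ¬'_  : Form → Form
  ©'_  : Form → Form

☆ : Form → Form
☆ α = ©' (©' α)

Valuation : Set
Valuation = ℕ → V4

eval : Valuation → Form → V4
eval v (var i) = v i
eval v (φ ∧' ψ) = eval v φ ∧₄ eval v ψ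
eval v (φ ∨' ψ) = eval v φ ∨₄ eval v ψ
eval v (φ ⇒' ψ) = eval v φ ⇒₄ eval v ψ
eval v (¬' φ) = ¬₄ (eval v φ)
eval v (©' φ) = ©₄ (eval v φ)

vars : Form → List ℕ
vars (var i) = i ∷ []
vars (φ ∧' ψ) = vars φ ++ vars ψ
vars (φ ∨' ψ) = vars φ ++ vars ψ
vars (φ ⇒' ψ) = vars φ ++ vars ψ
vars (¬' φ) = vars φ
vars (©' φ) = vars φ

_⊨BD2_ : List Form → Form → Set
Γ ⊨BD2 ψ = (v : Valuation) → (∀ φ → φ ∈ Γ → Designated (eval v φ)) → Designated (eval v ψ)

-- LFI1: logic of the submatrix on {1, b, 0}.  Homomorphisms from the formula
-- algebra into the subalgebra are exactly the valuations into 4 whose values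
-- on variables avoid n (the subset {1,b,0} is closed under all operations).
ThreeValued : Valuation → Set
ThreeValued v = ∀ i → v i ≢ n

_⊨LFI1_ : List Form → Form → Set
Γ ⊨LFI1 ψ = (v : Valuation) → ThreeValued v →
  (∀ φ → φ ∈ Γ → Designated (eval v φ)) → Designated (eval v ψ)

-- On the subalgebra {1, b, 0} the operation ☆ = ©© is constantly 1, while ☆ n = 0;
-- so ☆ p is BD2-designated exactly when p avoids n. Collapsing n to 0 turns a BD2
-- valuation designating every ☆ p_j into an LFI1 valuation that agrees with it on the
-- relevant variables, and evaluation depends only on the variables of a formula.
module Submission where

open import Defs
open import Data.Nat using (ℕ)
open import Data.List using (List; _∷_; _++_; map; concatMap)
open import Data.List.Membership.Propositional using (_∈_; lose)
open import Data.List.Membership.Propositional.Properties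
  using (∈-++⁺ˡ; ∈-++⁺ʳ; ∈-++⁻; ∈-map⁺; ∈-map⁻; ∈-concatMap⁺)
open import Data.List.Relation.Unary.Any using (here)
open import Data.Empty using (⊥-elim)
open import Data.Product using (_,_)
open import Data.Sum using (inj₁; inj₂)
open import Function using (id)
open import Function.Bundles using (_⇔_; mk⇔)
open import Relation.Binary.PropositionalEquality using (_≡_; _≢_; refl; sym; cong; cong₂; subst)

designated-☆₄ : ∀ x → x ≢ n → Designated (©₄ (©₄ x))
designated-☆₄ one  _   = des-one
designated-☆₄ b    _   = des-one
designated-☆₄ n    x≢n = ⊥-elim (x≢n refl)
designated-☆₄ zero _   = des-one

designated-☆₄⇒≢n : ∀ x → Designated (©₄ (©₄ x)) → x ≢ n
designated-☆₄⇒≢n n () refl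

collapse-n : V4 → V4
collapse-n n = zero
collapse-n x = x

collapse-n-≢n : ∀ x → collapse-n x ≢ n
collapse-n-≢n one  ()
collapse-n-≢n b    ()
collapse-n-≢n n    ()
collapse-n-≢n zero ()

collapse-n-id : ∀ x → x ≢ n → collapse-n x ≡ x
collapse-n-id one  _   = refl
collapse-n-id b    _   = refl
collapse-n-id n    x≢n = ⊥-elim (x≢n refl)
collapse-n-id zero _   = refl

_≗[_]_ : Valuation → List ℕ → Valuation → Set
v ≗[ xs ] w = ∀ {i} → i ∈ xs → v i ≡ w i

module _ {v w : Valuation} where

  ≗-sym : ∀ {xs} → v ≗[ xs ] w → w ≗[ xs ] v
  ≗-sym v≗w i∈xs = sym (v≗w i∈xs)

  ≗-++ˡ : ∀ {xs ys} → v ≗[ xs ++ ys ] w → v ≗[ xs ] w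
  ≗-++ˡ v≗w i∈xs = v≗w (∈-++⁺ˡ i∈xs)

  ≗-++ʳ : ∀ xs {ys} → v ≗[ xs ++ ys ] w → v ≗[ ys ] w
  ≗-++ʳ xs v≗w i∈ys = v≗w (∈-++⁺ʳ xs i∈ys)

  ≗-concatMap-vars : ∀ {φ Γ} → φ ∈ Γ → v ≗[ concatMap vars Γ ] w → v ≗[ vars φ ] w
  ≗-concatMap-vars φ∈Γ v≗w i∈φ = v≗w (∈-concatMap⁺ vars (lose φ∈Γ i∈φ))

eval-cong : ∀ {v w} φ → v ≗[ vars φ ] w → eval v φ ≡ eval w φ
eval-cong (var i)  v≗w = v≗w (here refl)
eval-cong (φ ∧' ψ) v≗w = cong₂ _∧₄_ (eval-cong φ (≗-++ˡ v≗w)) (eval-cong ψ (≗-++ʳ (vars φ) v≗w))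
eval-cong (φ ∨' ψ) v≗w = cong₂ _∨₄_ (eval-cong φ (≗-++ˡ v≗w)) (eval-cong ψ (≗-++ʳ (vars φ) v≗w))
eval-cong (φ ⇒' ψ) v≗w = cong₂ _⇒₄_ (eval-cong φ (≗-++ˡ v≗w)) (eval-cong ψ (≗-++ʳ (vars φ) v≗w))
eval-cong (¬' φ)   v≗w = cong ¬₄ (eval-cong φ v≗w)
eval-cong (©' φ)   v≗w = cong ©₄ (eval-cong φ v≗w)

_⊩_ : Valuation → List Form → Set
v ⊩ Γ = ∀ φ → φ ∈ Γ → Designated (eval v φ)

⊩-cong : ∀ {v w} Γ → v ≗[ concatMap vars Γ ] w → v ⊩ Γ → w ⊩ Γ
⊩-cong Γ v≗w v⊩Γ φ φ∈Γ =
  subst Designated (eval-cong φ (≗-concatMap-vars φ∈Γ v≗w)) (v⊩Γ φ φ∈Γ)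

⊩-++⁺ : ∀ {v} Γ {Δ} → v ⊩ Γ → v ⊩ Δ → v ⊩ (Γ ++ Δ)
⊩-++⁺ Γ v⊩Γ v⊩Δ φ φ∈Γ++Δ with ∈-++⁻ Γ φ∈Γ++Δ
... | inj₁ φ∈Γ = v⊩Γ φ φ∈Γ
... | inj₂ φ∈Δ = v⊩Δ φ φ∈Δ

⊩-++⁻ˡ : ∀ {v Γ Δ} → v ⊩ (Γ ++ Δ) → v ⊩ Γ
⊩-++⁻ˡ v⊩ φ φ∈Γ = v⊩ φ (∈-++⁺ˡ φ∈Γ)

⊩-++⁻ʳ : ∀ {v} Γ {Δ} → v ⊩ (Γ ++ Δ) → v ⊩ Δ
⊩-++⁻ʳ Γ v⊩ φ φ∈Δ = v⊩ φ (∈-++⁺ʳ Γ φ∈Δ)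

☆vars : List ℕ → List Form
☆vars = map (λ i → ☆ (var i))

⊩-☆vars⁺ : ∀ {v} xs → ThreeValued v → v ⊩ ☆vars xs
⊩-☆vars⁺ {v} xs v-3 φ φ∈☆xs with ∈-map⁻ (λ i → ☆ (var i)) φ∈☆xs
... | i , _ , refl = designated-☆₄ (v i) (v-3 i)

⊩-☆vars⁻ : ∀ {v} xs → v ⊩ ☆vars xs → ∀ {i} → i ∈ xs → v i ≢ n
⊩-☆vars⁻ {v} xs v⊩ {i} i∈xs =
  designated-☆₄⇒≢n (v i) (v⊩ (☆ (var i)) (∈-map⁺ (λ j → ☆ (var j)) i∈xs))

⊨BD2-☆vars⇒⊨LFI1 : ∀ Γ ψ xs → (Γ ++ ☆vars xs) ⊨BD2 ψ → Γ ⊨LFI1 ψ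
⊨BD2-☆vars⇒⊨LFI1 Γ ψ xs ⊨ψ v v-3 v⊩Γ = ⊨ψ v (⊩-++⁺ Γ v⊩Γ (⊩-☆vars⁺ xs v-3))

⊨LFI1⇒⊨BD2-☆vars : ∀ Γ ψ xs → (∀ {i} → i ∈ concatMap vars (ψ ∷ Γ) → i ∈ xs) →
                    Γ ⊨LFI1 ψ → (Γ ++ ☆vars xs) ⊨BD2 ψ
⊨LFI1⇒⊨BD2-☆vars Γ ψ xs covers ⊨ψ v v⊩ =
  subst Designated (eval-cong ψ (≗-++ˡ w≗v))
    (⊨ψ w (λ i → collapse-n-≢n (v i)) (⊩-cong Γ (≗-sym (≗-++ʳ (vars ψ) w≗v)) (⊩-++⁻ˡ v⊩)))
  where
  w : Valuation
  w i = collapse-n (v i)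

  w≗v : w ≗[ concatMap vars (ψ ∷ Γ) ] v
  w≗v {i} i∈ψΓ = collapse-n-id (v i) (⊩-☆vars⁻ xs (⊩-++⁻ʳ Γ v⊩) (covers i∈ψΓ))

mainTheorem4 : (Γ : List Form) (ψ : Form) →
    (Γ ⊨LFI1 ψ) ⇔ ((Γ ++ map (λ i → ☆ (var i)) (concatMap vars (ψ ∷ Γ))) ⊨BD2 ψ)
mainTheorem4 Γ ψ =
  mk⇔ (⊨LFI1⇒⊨BD2-☆vars Γ ψ xs id) (⊨BD2-☆vars⇒⊨LFI1 Γ ψ xs)
  where
  xs : List ℕ
  xs = concatMap vars (ψ ∷ Γ)
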